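{- Let $r>2$ and $n\ge r$ be integers such that $n$ is not divisible by $r$. Then the Turán graph $T(n,r)$ is not a $G$-graph.
   Context: For integers $1\le r\le n$, the Turán graph $T(n,r)$ is the complete $r$-partite simple graph on $n$ vertices whose parts have sizes $\lceil n/r\rceil$ or $\lfloor n/r\rfloor$ (there are $n \bmod r$ parts of size $\lceil n/r\rceil$ and the rest of size $\lfloor n/r\rfloor$); two vertices are adjacent iff they lie in different parts. For a group $G$ and a finite family $S=\{s_1,\dots,s_k\}$ of elements generating $G$ (repetitions allowed), the $G$-graph $\Gamma(G,S)$ is the loopless multigraph with vertex set the disjoint union of the sets $V_{s_i}$ of right cosets $\langle s_i\rangle x$ ($x\in G$), where for $i\ne j$, $\langle s_i\rangle x$ and $\langle s_j\rangle y$ are joined by exactly $|\langle s_i\rangle x\cap\langle s_j\rangle y|$ parallel edges and vertices in the same $V_{s_i}$ are non-adjacent. A graph is a $G$-graph if it is isomorphic to $\Gamma(G,S)$ for some group $G$ and some finite generating (multi)set $S$. -}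

module Defs where

open import Level using (Level; _⊔_)
open import Algebra.Bundles using (Group)
open import Data.Nat using (ℕ; zero; suc; _%_)
open import Data.Integer using (ℤ; +_; -[1+_])
open import Data.Fin using (Fin; toℕ)
open import Data.Product using (Σ; ∃; _×_; _,_)
open import Data.Sum using (_⊎_)
open import Relation.Binary.PropositionalEquality using (_≡_; _≢_)
open import Relation.Nullary using (¬_)

-- Turán graph T(n,r) on vertex set Fin n: vertex u lies in part
-- (toℕ u mod r).  Residues < n mod r get ⌈n/r⌉ vertices, the others
-- ⌊n/r⌋, so this is exactly T(n,r) (up to relabelling).

turanPart : ℕ → ℕ → ℕ
turanPart zero    m = m
turanPart (suc r) m = m % suc r

TuranAdj : (n r : ℕ) → Fin n → Fin n → Set
TuranAdj n r u v = turanPart r (toℕ u) ≢ turanPart r (toℕ v)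

module GGraph {c ℓ : Level} (G : Group c ℓ) where
  open Group G

  natPow : Carrier → ℕ → Carrier
  natPow x zero    = ε
  natPow x (suc m) = x ∙ natPow x m

  intPow : Carrier → ℤ → Carrier
  intPow x (+ m)      = natPow x m
  intPow x -[1+ m ]   = natPow (x ⁻¹) (suc m)

  data Generated {k : ℕ} (s : Fin k → Carrier) : Carrier → Set (c ⊔ ℓ) where
    gen  : ∀ i → Generated s (s i)
    unit : Generated s ε
    mul  : ∀ {x y} → Generated s x → Generated s y → Generated s (x ∙ y)
    inv  : ∀ {x} → Generated s x → Generated s (x ⁻¹)
    resp : ∀ {x y} → x ≈ y → Generated s x → Generated s y

  Generates : {k : ℕ} → (Fin k → Carrier) → Set (c ⊔ ℓ)
  Generates s = ∀ g → Generated s g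

  InCoset : Carrier → Carrier → Carrier → Set ℓ
  InCoset a x z = ∃ λ (m : ℤ) → z ≈ intPow a m ∙ x

  -- vertices of Γ(G,S): pairs (i , x) representing the coset ⟨s_i⟩x
  Vertex : ℕ → Set c
  Vertex k = Fin k × Carrier

  module _ {k : ℕ} (s : Fin k → Carrier) where
    SameVertex : Vertex k → Vertex k → Set ℓ
    SameVertex (i , x) (j , y) = i ≡ j × InCoset (s i) y x

    NoEdge : Vertex k → Vertex k → Set (c ⊔ ℓ)
    NoEdge (i , x) (j , y) =
      i ≡ j ⊎ (∀ z → InCoset (s i) x z → InCoset (s j) y z → Data.Empty.⊥)
      where import Data.Empty

    OneEdge : Vertex k → Vertex k → Set (c ⊔ ℓ)
    OneEdge (i , x) (j , y) =
      i ≢ j ×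
      (∃ λ z → InCoset (s i) x z × InCoset (s j) y z) ×
      (∀ z w → InCoset (s i) x z → InCoset (s j) y z
             → InCoset (s i) x w → InCoset (s j) y w → z ≈ w)

    -- f : Fin n → vertices is an isomorphism from T(n,r) onto Γ(G,S)
    -- (as multigraphs: bijective on vertices, edge multiplicities match)
    IsTuranIso : (n r : ℕ) → (Fin n → Vertex k) → Set (c ⊔ ℓ)
    IsTuranIso n r f =
      (∀ u v → SameVertex (f u) (f v) → u ≡ v) ×
      (∀ w → ∃ λ u → SameVertex (f u) w) ×
      (∀ u v → (TuranAdj n r u v → OneEdge (f u) (f v)) ×
               (¬ TuranAdj n r u v → NoEdge (f u) (f v)))

    TuranIsoToΓ : (n r : ℕ) → Set (c ⊔ ℓ)
    TuranIsoToΓ n r = ∃ λ (f : Fin n → Vertex k) → IsTuranIso n r f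

module Submission where

open import Defs
open import Algebra.Bundles using (Group)
open import Data.Nat using (ℕ; _<_; _≤_)
open import Data.Nat.Divisibility using (_∣_)
open import Data.Fin using (Fin)
open import Relation.Nullary using (¬_)

open import Level using (Level; _⊔_)
open import Data.Nat using (zero; suc; _+_; _*_; _%_; _/_; s≤s⁻¹; NonZero)
open import Data.Nat.Properties
  using (_≟_; ≤-trans; <⇒≤; <-irrefl; 1+n≰n; n<1+n; n≢0⇒n>0; *-cancelʳ-≡; *-cancelʳ-<; +-cancelˡ-<;
         +-monoˡ-≤; *-monoˡ-≤; +-monoˡ-<; module ≤-Reasoning)
open import Data.Nat.DivMod using (m≡m%n+[m/n]*n; m%n<n; m<n⇒m%n≡m; m*n%n≡0)
open import Data.Nat.Divisibility using (m%n≡0⇒n∣m)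
open import Data.Integer using (+_; -[1+_])
open import Data.Fin using (toℕ; fromℕ<)
open import Data.Fin.Properties using (toℕ-injective; toℕ<n; toℕ-fromℕ<; fromℕ<-injective; injective⇒≤)
open import Data.Product using (∃; _×_; _,_; proj₁; proj₂)
open import Data.Sum using (inj₁; inj₂)
open import Data.Empty using (⊥-elim)
open import Function.Definitions using (Injective)
open import Relation.Nullary using (yes; no)
open import Relation.Binary.PropositionalEquality as ≡ using (_≡_; _≢_)
import Algebra.Properties.Group as GroupProperties
import Relation.Binary.Reasoning.Setoid as SetoidReasoning

-- Suppose f is an isomorphism from T(n,r) onto Γ(G,S), and write
-- C(u) for the coset assigned to the vertex u.  Two vertices in different parts
-- are joined by exactly one edge, so their cosets meet in exactly one element;
-- two vertices in the same part are not adjacent, so their cosets are disjoint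
-- or belong to the same generator.  Fix u and b in different parts.  For v in a
-- third part, the unique point of C(u) ∩ C(v) lies in a unique coset of b's
-- generator, i.e. in C(w) for a unique w, which lies in b's part.  Since C(u)
-- and C(w) meet only once, v ↦ w is injective on each part, so every part
-- other than those of u and b is at most as large as b's part.  For r > 2 take
-- u, b in the parts of residues 1 and r-1 and compare with the part of residue
-- 0: if r ∤ n the latter has ⌊n/r⌋ + 1 vertices while the former has ⌊n/r⌋.

-- Membership in the right coset ⟨a⟩x is an equivalence relation.  It is proved
-- by showing that left multiplication by any power of a, or its inverse, maps
-- each coset of ⟨a⟩ into itself.
module Cosets {c ℓ : Level} (G : Group c ℓ) where
  open Group G
  open GGraph G
  open GroupProperties G using (ε⁻¹≈ε; ⁻¹-involutive; ⁻¹-anti-homo-∙; \\-leftDividesˡ; \\-leftDividesʳ)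
  open SetoidReasoning setoid

  coset-resp : ∀ {a x z z′} → z ≈ z′ → InCoset a x z → InCoset a x z′
  coset-resp z≈z′ (t , z≈aᵗx) = t , trans (sym z≈z′) z≈aᵗx

  coset-refl : ∀ {a x} → InCoset a x x
  coset-refl = + 0 , sym (identityˡ _)

  Stabilises : Carrier → Carrier → Set (c ⊔ ℓ)
  Stabilises a b = ∀ {x y} → InCoset a x y → InCoset a x (b ∙ y)

  stabilises-powers : ∀ {a b} → (∀ t → ∃ λ t′ → b ∙ intPow a t ≈ intPow a t′) → Stabilises a b
  stabilises-powers {a} {b} step {x} {y} (t , y≈aᵗx) with step t
  ... | t′ , b∙aᵗ≈aᵗ′ = t′ , (begin
    b ∙ y                 ≈⟨ ∙-congˡ y≈aᵗx ⟩
    b ∙ (intPow a t ∙ x)  ≈⟨ assoc b (intPow a t) x ⟨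
    (b ∙ intPow a t) ∙ x  ≈⟨ ∙-congʳ b∙aᵗ≈aᵗ′ ⟩
    intPow a t′ ∙ x       ∎)

  -- a and a⁻¹ shift the exponent by ±1
  stabilises-gen : ∀ a → Stabilises a a
  stabilises-gen a = stabilises-powers successor
    where
    successor : ∀ t → ∃ λ t′ → a ∙ intPow a t ≈ intPow a t′
    successor (+ m)          = + suc m , refl
    successor -[1+ zero ]    = + 0 , \\-leftDividesˡ a ε
    successor -[1+ suc m ]   = -[1+ m ] , \\-leftDividesˡ a (natPow (a ⁻¹) (suc m))

  stabilises-gen⁻¹ : ∀ a → Stabilises a (a ⁻¹)
  stabilises-gen⁻¹ a = stabilises-powers predecessor
    where
    predecessor : ∀ t → ∃ λ t′ → a ⁻¹ ∙ intPow a t ≈ intPow a t′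
    predecessor (+ zero)     = -[1+ 0 ] , refl
    predecessor (+ suc m)    = + m , \\-leftDividesʳ a (natPow a m)
    predecessor -[1+ m ]     = -[1+ suc m ] , refl

  stabilises-resp : ∀ {a b b′} → b ≈ b′ → Stabilises a b → Stabilises a b′
  stabilises-resp b≈b′ sb y∈ = coset-resp (∙-congʳ b≈b′) (sb y∈)

  stabilises-ε : ∀ {a} → Stabilises a ε
  stabilises-ε = coset-resp (sym (identityˡ _))

  stabilises-∙ : ∀ {a b b′} → Stabilises a b → Stabilises a b′ → Stabilises a (b ∙ b′)
  stabilises-∙ sb sb′ y∈ = coset-resp (sym (assoc _ _ _)) (sb (sb′ y∈))

  stabilises-natPow : ∀ {a b} → Stabilises a b → ∀ m → Stabilises a (natPow b m)
  stabilises-natPow sb zero    = stabilises-ε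
  stabilises-natPow sb (suc m) = stabilises-∙ sb (stabilises-natPow sb m)

  -- (b^(m+1))⁻¹ = (b^m)⁻¹ ∙ b⁻¹
  stabilises-natPow⁻¹ : ∀ {a b} → Stabilises a (b ⁻¹) → ∀ m → Stabilises a (natPow b m ⁻¹)
  stabilises-natPow⁻¹ sb⁻¹ zero    = stabilises-resp (sym ε⁻¹≈ε) stabilises-ε
  stabilises-natPow⁻¹ {b = b} sb⁻¹ (suc m) =
    stabilises-resp (sym (⁻¹-anti-homo-∙ b (natPow b m))) (stabilises-∙ (stabilises-natPow⁻¹ sb⁻¹ m) sb⁻¹)

  stabilises-intPow : ∀ a t → Stabilises a (intPow a t)
  stabilises-intPow a (+ m)      = stabilises-natPow (stabilises-gen a) m
  stabilises-intPow a -[1+ m ]   = stabilises-natPow (stabilises-gen⁻¹ a) (suc m)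

  stabilises-intPow⁻¹ : ∀ a t → Stabilises a (intPow a t ⁻¹)
  stabilises-intPow⁻¹ a (+ m)    = stabilises-natPow⁻¹ (stabilises-gen⁻¹ a) m
  stabilises-intPow⁻¹ a -[1+ m ] =
    stabilises-natPow⁻¹ (stabilises-resp (sym (⁻¹-involutive a)) (stabilises-gen a)) (suc m)

  -- z = aᵗx gives x = (aᵗ)⁻¹z
  coset-sym : ∀ {a x z} → InCoset a x z → InCoset a z x
  coset-sym {a} {x} {z} (t , z≈aᵗx) = coset-resp (begin
      intPow a t ⁻¹ ∙ z                 ≈⟨ ∙-congˡ z≈aᵗx ⟩
      intPow a t ⁻¹ ∙ (intPow a t ∙ x)  ≈⟨ \\-leftDividesʳ (intPow a t) x ⟩
      x                                 ∎)
    (stabilises-intPow⁻¹ a t coset-refl)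

  coset-trans : ∀ {a x y z} → InCoset a x y → InCoset a y z → InCoset a x z
  coset-trans {a} y∈ (t , z≈aᵗy) = coset-resp (sym z≈aᵗy) (stabilises-intPow a t y∈)

module TuranImage {c ℓ : Level} (G : Group c ℓ) {k : ℕ} (s : Fin k → Group.Carrier G)
                  (n R : ℕ) (f : Fin n → GGraph.Vertex G k)
                  (iso : GGraph.IsTuranIso G s n R f) where
  open Group G using (Carrier; _≈_; sym)
  open GGraph G
  open Cosets G

  part : Fin n → ℕ
  part u = turanPart R (toℕ u)

  index : Fin n → Fin k
  index u = proj₁ (f u)

  Contains : Fin n → Carrier → Set ℓ
  Contains u z = InCoset (s (index u)) (proj₂ (f u)) z

  private
    f-injective  = proj₁ iso
    f-surjective = proj₁ (proj₂ iso)
    f-edges      = proj₂ (proj₂ iso)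

  samePart⇒sameIndex : ∀ {u v z} → part u ≡ part v → Contains u z → Contains v z → index u ≡ index v
  samePart⇒sameIndex {u} {v} {z} u~v u∋z v∋z with proj₂ (f-edges u v) (λ u≁v → u≁v u~v)
  ... | inj₁ sameIndex = sameIndex
  ... | inj₂ disjoint  = ⊥-elim (disjoint z u∋z v∋z)

  -- adjacent vertices use different generators
  sameIndex⇒samePart : ∀ {u v} → index u ≡ index v → part u ≡ part v
  sameIndex⇒samePart {u} {v} sameIndex with part u ≟ part v
  ... | yes u~v = u~v
  ... | no  u≁v = ⊥-elim (proj₁ (proj₁ (f-edges u v) u≁v) sameIndex)

  meet : ∀ {u v} → part u ≢ part v → ∃ λ z → Contains u z × Contains v z
  meet {u} {v} u≁v = proj₁ (proj₂ (proj₁ (f-edges u v) u≁v))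

  meet-unique : ∀ {u v z w} → part u ≢ part v →
                Contains u z → Contains v z → Contains u w → Contains v w → z ≈ w
  meet-unique {u} {v} {z} {w} u≁v = proj₂ (proj₂ (proj₁ (f-edges u v) u≁v)) z w

  -- within a part, meeting cosets coincide, hence so do the vertices
  samePart-meet⇒equal : ∀ {u v z} → part u ≡ part v → Contains u z → Contains v z → u ≡ v
  samePart-meet⇒equal {u} {v} {z} u~v u∋z v∋z =
    f-injective u v (sameIndex , coset-trans v∋z′ (coset-sym u∋z))
    where
    sameIndex : index u ≡ index v
    sameIndex = samePart⇒sameIndex u~v u∋z v∋z
    v∋z′ : InCoset (s (index u)) (proj₂ (f v)) z
    v∋z′ = ≡.subst (λ i → InCoset (s i) (proj₂ (f v)) z) (≡.sym sameIndex) v∋z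

  through : ∀ i z → ∃ λ w → index w ≡ i × Contains w z
  through i z with f-surjective (i , z)
  ... | w , sameIndex , w∈ = w , sameIndex , coset-sym w∈

  -- With u and b in different parts, v ↦ (vertex of b's generator through the
  -- point C(u) ∩ C(v)) sends a part avoiding u's into b's part, injectively.
  module Transfer (u b : Fin n) (u≁b : part u ≢ part b) where
    point : ∀ {v} → part u ≢ part v → Carrier
    point u≁v = proj₁ (meet u≁v)

    u∋point : ∀ {v} (u≁v : part u ≢ part v) → Contains u (point u≁v)
    u∋point u≁v = proj₁ (proj₂ (meet u≁v))

    v∋point : ∀ {v} (u≁v : part u ≢ part v) → Contains v (point u≁v)
    v∋point u≁v = proj₂ (proj₂ (meet u≁v))

    transfer : ∀ v → part u ≢ part v → Fin n
    transfer v u≁v = proj₁ (through (index b) (point u≁v))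

    transfer∋point : ∀ {v} (u≁v : part u ≢ part v) → Contains (transfer v u≁v) (point u≁v)
    transfer∋point u≁v = proj₂ (proj₂ (through (index b) (point u≁v)))

    transfer-part : ∀ v (u≁v : part u ≢ part v) → part (transfer v u≁v) ≡ part b
    transfer-part v u≁v = sameIndex⇒samePart (proj₁ (proj₂ (through (index b) (point u≁v))))

    -- equal transfers force equal meeting points (C(u) and C(w) meet once),
    -- and within one part a shared point forces equal vertices
    transfer-injective : ∀ {v v′} (u≁v : part u ≢ part v) (u≁v′ : part u ≢ part v′) →
                         part v ≡ part v′ → transfer v u≁v ≡ transfer v′ u≁v′ → v ≡ v′
    transfer-injective {v} {v′} u≁v u≁v′ v~v′ sameTransfer =
      samePart-meet⇒equal v~v′ (v∋point u≁v) (coset-resp (sym points≈) (v∋point u≁v′))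
      where
      u≁w : part u ≢ part (transfer v u≁v)
      u≁w u~w = u≁b (≡.trans u~w (transfer-part v u≁v))
      w∋point′ : Contains (transfer v u≁v) (point u≁v′)
      w∋point′ = ≡.subst (λ w → Contains w (point u≁v′)) (≡.sym sameTransfer) (transfer∋point u≁v′)
      points≈ : point u≁v ≈ point u≁v′
      points≈ = meet-unique u≁w (u∋point u≁v) (transfer∋point u≁v) (u∋point u≁v′) w∋point′

    transfer-family : ∀ {m p} (e : Fin m → Fin n) → (∀ t → part (e t) ≡ p) → part u ≢ p → Injective _≡_ _≡_ e →
                      ∃ λ (g : Fin m → Fin n) → (∀ t → part (g t) ≡ part b) × Injective _≡_ _≡_ g
    transfer-family e e-part u≁p e-injective =
      (λ t → transfer (e t) (u≁e t)) ,
      (λ t → transfer-part (e t) (u≁e t)) ,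
      λ {t} {t′} same →
        e-injective (transfer-injective (u≁e t) (u≁e t′) (≡.trans (e-part t) (≡.sym (e-part t′))) same)
      where
      u≁e : ∀ t → part u ≢ part (e t)
      u≁e t u~e = u≁p (≡.trans u~e (e-part t))

-- Counting in the residue classes of Fin n modulo R, where a vertex v of
-- T(n,R) lies in the class toℕ v % R and is determined by (v % R, v / R).
module ResidueClasses (n R : ℕ) .{{_ : NonZero R}} where
  open ≤-Reasoning

  residue : ∀ p → p < R → R ≤ n → Fin n
  residue p p<R R≤n = fromℕ< (≤-trans p<R R≤n)

  residue-part : ∀ p (p<R : p < R) (R≤n : R ≤ n) → toℕ (residue p p<R R≤n) % R ≡ p
  residue-part p p<R R≤n = ≡.trans (≡.cong (_% R) (toℕ-fromℕ< (≤-trans p<R R≤n))) (m<n⇒m%n≡m p<R)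

  quotient-injective : ∀ {v w : Fin n} → toℕ v % R ≡ toℕ w % R → toℕ v / R ≡ toℕ w / R → v ≡ w
  quotient-injective {v} {w} sameRem sameQuot = toℕ-injective (begin-equality
    toℕ v                      ≡⟨ m≡m%n+[m/n]*n (toℕ v) R ⟩
    toℕ v % R + toℕ v / R * R  ≡⟨ ≡.cong₂ (λ x y → x + y * R) sameRem sameQuot ⟩
    toℕ w % R + toℕ w / R * R  ≡⟨ m≡m%n+[m/n]*n (toℕ w) R ⟨
    toℕ w                      ∎)

  quotient-bound : ∀ (v : Fin n) → n % R ≤ toℕ v % R → toℕ v / R < n / R
  quotient-bound v rem≤ = *-cancelʳ-< R _ _ (+-cancelˡ-< (toℕ v % R) _ _ (begin-strict
    toℕ v % R + toℕ v / R * R  ≡⟨ m≡m%n+[m/n]*n (toℕ v) R ⟨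
    toℕ v                      <⟨ toℕ<n v ⟩
    n                          ≡⟨ m≡m%n+[m/n]*n n R ⟩
    n % R + n / R * R          ≤⟨ +-monoˡ-≤ (n / R * R) rem≤ ⟩
    toℕ v % R + n / R * R      ∎))

  class-size : ∀ {m p} (g : Fin m → Fin n) → (∀ t → toℕ (g t) % R ≡ p) → n % R ≤ p →
               Injective _≡_ _≡_ g → m ≤ n / R
  class-size {m} g g-rem rem≤ g-injective = injective⇒≤ {f = quotient} quotient-injective-on-class
    where
    bound : ∀ t → toℕ (g t) / R < n / R
    bound t = quotient-bound (g t) (≡.subst (n % R ≤_) (≡.sym (g-rem t)) rem≤)
    quotient : Fin m → Fin (n / R)
    quotient t = fromℕ< (bound t)
    quotient-injective-on-class : Injective _≡_ _≡_ quotient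
    quotient-injective-on-class {t} {t′} same = g-injective (quotient-injective
      (≡.trans (g-rem t) (≡.sym (g-rem t′))) (fromℕ<-injective _ _ (bound t) (bound t′) same))

  -- if R ∤ n, the residue class 0 contains the n / R + 1 multiples 0, R, …, (n / R)·R
  module Multiples (R∤n : 0 < n % R) where
    multiple<n : (t : Fin (suc (n / R))) → toℕ t * R < n
    multiple<n t = begin-strict
      toℕ t * R          ≤⟨ *-monoˡ-≤ R (s≤s⁻¹ (toℕ<n t)) ⟩
      n / R * R          <⟨ +-monoˡ-< (n / R * R) R∤n ⟩
      n % R + n / R * R  ≡⟨ m≡m%n+[m/n]*n n R ⟨
      n                  ∎

    multiple : Fin (suc (n / R)) → Fin n
    multiple t = fromℕ< (multiple<n t)

    multiple-part : ∀ t → toℕ (multiple t) % R ≡ 0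
    multiple-part t = ≡.trans (≡.cong (_% R) (toℕ-fromℕ< (multiple<n t))) (m*n%n≡0 (toℕ t) R)

    multiple-injective : Injective _≡_ _≡_ multiple
    multiple-injective {t} {t′} same = toℕ-injective (*-cancelʳ-≡ (toℕ t) (toℕ t′) R (begin-equality
      toℕ t * R             ≡⟨ toℕ-fromℕ< (multiple<n t) ⟨
      toℕ (multiple t)      ≡⟨ ≡.cong toℕ same ⟩
      toℕ (multiple t′)     ≡⟨ toℕ-fromℕ< (multiple<n t′) ⟩
      toℕ t′ * R            ∎))

-- Take u = 1 and b = r - 1 (distinct parts, both ≠ 0 as r > 2).
proposition6p3p4 : (n r : ℕ) → 2 < r → r ≤ n → ¬ (r ∣ n) →
    ∀ {c ℓ} (G : Group c ℓ) (k : ℕ) (s : Fin k → Group.Carrier G) →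
    GGraph.Generates G s → ¬ GGraph.TuranIsoToΓ G s n r
proposition6p3p4 n zero () _ _ _ _ _ _
proposition6p3p4 n r@(suc r′) 2<r r≤n r∤n G k s _ (f , iso) =
  1+n≰n (class-size image image-part (s≤s⁻¹ (m%n<n n r)) image-injective)
  where
  open TuranImage G s n r f iso
  open ResidueClasses n r
  open Multiples (n≢0⇒n>0 (λ n%r≡0 → r∤n (m%n≡0⇒n∣m n r n%r≡0)))

  u b : Fin n
  u = residue 1 (<⇒≤ 2<r) r≤n
  b = residue r′ (n<1+n r′) r≤n

  part-u : part u ≡ 1
  part-u = residue-part 1 (<⇒≤ 2<r) r≤n

  part-b : part b ≡ r′
  part-b = residue-part r′ (n<1+n r′) r≤n

  u≁b : part u ≢ part b
  u≁b u~b = <-irrefl (≡.cong suc (≡.trans (≡.sym part-u) (≡.trans u~b part-b))) 2<r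

  u≁0 : part u ≢ 0
  u≁0 u~0 with ≡.trans (≡.sym part-u) u~0
  ... | ()

  open Transfer u b u≁b

  transferred : ∃ λ (g : Fin (suc (n / r)) → Fin n) → (∀ t → part (g t) ≡ part b) × Injective _≡_ _≡_ g
  transferred = transfer-family multiple multiple-part u≁0 multiple-injective

  image : Fin (suc (n / r)) → Fin n
  image = proj₁ transferred

  image-part : ∀ t → part (image t) ≡ r′
  image-part t = ≡.trans (proj₁ (proj₂ transferred) t) part-b

  image-injective : Injective _≡_ _≡_ image
  image-injective = proj₂ (proj₂ transferred)
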